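{- Let $t, r, s$ be integers with $1 \leq t \leq r$. Let $\mathcal{H}$ be a hereditary family with $\mu(\mathcal{H}) \geq 2r - t$, let $\emptyset \neq \mathcal{A} \subseteq \mathcal{H}^{(r)}$, and let $\mathcal{B}$ be a non-empty family of $s$-element sets that is not a trivial $t$-intersecting family, such that $\mathcal{A}$ and $\mathcal{B}$ are cross-$t$-intersecting. Then there exists a $t$-element set $T$ such that \[|\mathcal{A}| < \frac{s(r-t)}{\mu(\mathcal{H})-r}{s \choose t} |\mathcal{H}^{(r)}(T)|\] and $T \subseteq B$ for some $B \in \mathcal{B}$.
   Context: All sets and families (sets of sets) are finite. A family $\mathcal{H}$ is hereditary if for every $A \in \mathcal{H}$, every subset of $A$ is in $\mathcal{H}$. For a family $\mathcal{F}$, $\mathcal{F}^{(r)}$ denotes the family of $r$-element sets in $\mathcal{F}$, and for a set $T$, $\mathcal{F}(T) = \{A \in \mathcal{F} \colon T \subseteq A\}$. A set $B \in \mathcal{F}$ is a base of $\mathcal{F}$ if $B$ is not a proper subset of any $A \in \mathcal{F}$; $\mu(\mathcal{F})$ is the size of a smallest base of $\mathcal{F}$. Families $\mathcal{A}, \mathcal{B}$ are cross-$t$-intersecting if $|A \cap B| \geq t$ for all $A \in \mathcal{A}$, $B \in \mathcal{B}$. A family is $t$-intersecting if any two of its sets share at least $t$ elements; a $t$-intersecting family is trivial if all its sets have at least $t$ common elements. -}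

module Defs where

open import Data.Nat using (ℕ; zero; suc; _≤_)
open import Data.Bool using (Bool; true; false; T)
open import Data.Vec using (Vec; []; _∷_)
open import Data.List using (List; []; _∷_; _++_; map; filter; length)
open import Data.Fin.Subset using (Subset; _⊆_; ∣_∣; _∩_)
open import Data.Product using (Σ; _×_; ∃)
open import Relation.Binary.PropositionalEquality using (_≡_)
open import Relation.Nullary using (¬_)
import Relation.Nullary.Decidable as Dec
import Data.Bool
import Data.Nat
import Data.Fin.Subset.Properties

-- The ground set is Fin n (any finite collection of finite sets embeds into
-- some Fin n).  A family of subsets of Fin n is given by its (Boolean)
-- membership function.
Family : ℕ → Set
Family n = Subset n → Bool

_∈F_ : ∀ {n} → Subset n → Family n → Set
X ∈F F = T (F X)

allSubsets : (n : ℕ) → List (Subset n)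
allSubsets zero = [] ∷ []
allSubsets (suc n) = map (true ∷_) (allSubsets n) ++ map (false ∷_) (allSubsets n)

card : ∀ {n} → Family n → ℕ
card {n} F = length (filter (λ X → Dec.T? (F X)) (allSubsets n))

_⊆F_ : ∀ {n} → Family n → Family n → Set
F ⊆F G = ∀ X → X ∈F F → X ∈F G

Hereditary : ∀ {n} → Family n → Set
Hereditary H = ∀ A B → A ∈F H → B ⊆ A → B ∈F H

IsBase : ∀ {n} → Family n → Subset n → Set
IsBase F B = B ∈F F × (∀ A → A ∈F F → B ⊆ A → B ≡ A)

IsMu : ∀ {n} → Family n → ℕ → Set
IsMu F m = (Σ _ λ B → IsBase F B × ∣ B ∣ ≡ m) × (∀ B → IsBase F B → m ≤ ∣ B ∣)

uniformContaining : ∀ {n} → Family n → ℕ → Subset n → Family n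
uniformContaining F r S A = F A Data.Bool.∧ (Dec.⌊ ∣ A ∣ Data.Nat.≟ r ⌋ Data.Bool.∧ Dec.⌊ S Data.Fin.Subset.Properties.⊆? A ⌋)

CrossIntersecting : ∀ {n} → ℕ → Family n → Family n → Set
CrossIntersecting t A B = ∀ X Y → X ∈F A → Y ∈F B → t ≤ ∣ X ∩ Y ∣

TIntersecting : ∀ {n} → ℕ → Family n → Set
TIntersecting t F = CrossIntersecting t F F

TrivialTIntersecting : ∀ {n} → ℕ → Family n → Set
TrivialTIntersecting t F = TIntersecting t F × (Σ _ λ C → t ≤ ∣ C ∣ × (∀ X → X ∈F F → C ⊆ X))

Uniform : ∀ {n} → ℕ → Family n → Set
Uniform r F = ∀ X → X ∈F F → ∣ X ∣ ≡ r

NonemptyF : ∀ {n} → Family n → Set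
NonemptyF F = Σ _ λ X → X ∈F F

module Submission where

-- Fix B₀ ∈ ℬ and let 𝒯 be the family of t-subsets of B₀, so |𝒯| = (s choose t).
-- As ℬ is not trivial, every T ∈ 𝒯 is missed by some B_T ∈ ℬ.  Each A ∈ 𝒜 contains
-- some T ∈ 𝒯 (as |A ∩ B₀| ≥ t), and then also some x ∈ B_T ∖ T (as |A ∩ B_T| ≥ t
-- while T ⊈ B_T); hence |𝒜| ≤ Σ_{T ∈ 𝒯} Σ_{x ∈ B_T ∖ T} |ℋ⁽ʳ⁾(T ∪ {x})|.
-- Each term is bounded by shifting: for A ∈ ℋ⁽ʳ⁾(T) with x ∈ A, the set A − x lies in
-- a base of size ≥ μ, which supplies μ − r elements y ∉ A with A − x + y ∈ ℋ; each of
-- the resulting sets A′ ∈ ℋ⁽ʳ⁾(T) with x ∉ A′ arises from at most r − t pairs (A, y).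
-- So (μ − r + 1)|ℋ⁽ʳ⁾(T ∪ {x})| ≤ (r − t)|ℋ⁽ʳ⁾(T)|; summing over the at most s
-- choices of x and averaging over T ∈ 𝒯 produces the required T.

open import Algebra.Properties.CommutativeSemigroup using (interchange; x∙yz≈y∙xz)
open import Data.Bool using (Bool; true; false; _∧_; not; T)
open import Data.Bool.Properties using (T-∧; T-≡; ∧-zeroʳ; ∧-identityʳ)
import Data.Bool.Properties as Bool
open import Data.Empty using (⊥-elim)
open import Data.Fin using (Fin; zero; suc)
import Data.Fin.Properties as Fin
open import Data.Fin.Permutation.Components using (transpose; transpose-inverse)
open import Data.Fin.Subset using (Subset; _⊆_; _∈_; _∉_; ∣_∣; _∩_; _─_; _-_; ⊥; inside; outside)
open import Data.Fin.Subset.Properties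
  using ( _⊆?_; _∈?_; anySubset?; ⊆-refl; ⊆-trans; ⊆-antisym; ⊆-min; s⊆s; out⊆; drop-∷-⊆
        ; p⊆q⇒∣p∣≤∣q∣; p⊂q⇒∣p∣<∣q∣; ∣p∣≤n; ∣⊥∣≡0; ∣p─q∣≤∣p∣; p─q⊆p
        ; p∩q⊆p; p∩q⊆q; x∈p∩q⁺; x∈p∩q⁻; x∈p∧x∉q⇒x∈p─q; x∈p∧x≢y⇒x∈p-y )
open import Data.List using (List; []; _∷_; _++_; map; filter; length; allFin)
open import Data.List.Properties using (map-tabulate)
open import Data.Nat using (ℕ; zero; suc; _+_; _*_; _∸_; _≤_; _<_; z≤n; s≤s; _≟_; _<?_; >-nonZero)
open import Data.Nat.Combinatorics using (_C_; nCk+nC[k+1]≡[n+1]C[k+1])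
open import Data.Nat.Properties
open import Data.Nat.Solver using (module +-*-Solver)
open import Data.Product using (Σ; _×_; _,_; proj₁; proj₂; ∃)
open import Data.Unit using (tt)
open import Data.Vec using ([]; _∷_; lookup; here)
import Data.Vec as Vec
import Data.Vec.Properties as Vec
open import Function using (_∘_; id; Equivalence)
open import Relation.Binary using (DecidableEquality)
open import Relation.Binary.PropositionalEquality
open import Relation.Nullary using (¬_; yes; no; does)
open import Relation.Nullary.Decidable
  using (⌊_⌋; _×-dec_; ¬?; T?; dec-true; decidable-stable; isYes≗does; toWitness; fromWitness)

open import Defs

χ : Bool → ℕ
χ true  = 1
χ false = 0

χ-∧ : ∀ b c → χ (b ∧ c) ≡ χ b * χ c
χ-∧ true  c = sym (*-identityˡ (χ c))
χ-∧ false c = refl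

χ-mono : ∀ {b c} → (T b → T c) → χ b ≤ χ c
χ-mono {false}        _   = z≤n
χ-mono {true} {true}  _   = ≤-refl
χ-mono {true} {false} b⇒c = ⊥-elim (b⇒c tt)

χ≤ : ∀ b {k} → (T b → 0 < k) → χ b ≤ k
χ≤ true  0<k = 0<k tt
χ≤ false _   = z≤n

χ-pos : ∀ {b} → 0 < χ b → T b
χ-pos {true} _ = tt

χ*-pos : ∀ b {i} → 0 < χ b * i → T b
χ*-pos true _ = tt

χ*-mono-≤ : ∀ b {i j} → (T b → i ≤ j) → χ b * i ≤ χ b * j
χ*-mono-≤ true  i≤j = *-monoʳ-≤ 1 (i≤j tt)
χ*-mono-≤ false _   = z≤n

T-∧⁻ : ∀ b {c} → T (b ∧ c) → T b × T c
T-∧⁻ b = Equivalence.to (T-∧ {b})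

T-∧⁺ : ∀ b {c} → T b → T c → T (b ∧ c)
T-∧⁺ b Tb Tc = Equivalence.from (T-∧ {b}) (Tb , Tc)

∑ : {X : Set} → List X → (X → ℕ) → ℕ
∑ []       f = 0
∑ (x ∷ xs) f = f x + ∑ xs f

syntax ∑ xs (λ x → e) = ∑[ x ∈ xs ] e

module _ {X : Set} where

  ∑-cong : ∀ xs {f g : X → ℕ} → (∀ x → f x ≡ g x) → ∑ xs f ≡ ∑ xs g
  ∑-cong []       f≗g = refl
  ∑-cong (x ∷ xs) f≗g = cong₂ _+_ (f≗g x) (∑-cong xs f≗g)

  ∑-mono-≤ : ∀ xs {f g : X → ℕ} → (∀ x → f x ≤ g x) → ∑ xs f ≤ ∑ xs g
  ∑-mono-≤ []       f≤g = z≤n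
  ∑-mono-≤ (x ∷ xs) f≤g = +-mono-≤ (f≤g x) (∑-mono-≤ xs f≤g)

  ∑-zero : ∀ (xs : List X) → ∑[ x ∈ xs ] 0 ≡ 0
  ∑-zero []       = refl
  ∑-zero (x ∷ xs) = ∑-zero xs

  ∑-distrib-+ : ∀ xs (f g : X → ℕ) → ∑[ x ∈ xs ] (f x + g x) ≡ ∑ xs f + ∑ xs g
  ∑-distrib-+ []       f g = refl
  ∑-distrib-+ (x ∷ xs) f g = trans (cong (f x + g x +_) (∑-distrib-+ xs f g))
                                   (interchange +-commutativeSemigroup (f x) (g x) (∑ xs f) (∑ xs g))

  *-distribˡ-∑ : ∀ c xs (f : X → ℕ) → c * ∑ xs f ≡ ∑[ x ∈ xs ] (c * f x)
  *-distribˡ-∑ c []       f = *-zeroʳ c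
  *-distribˡ-∑ c (x ∷ xs) f = trans (*-distribˡ-+ c (f x) (∑ xs f)) (cong (c * f x +_) (*-distribˡ-∑ c xs f))

  ∑-++ : ∀ xs ys (f : X → ℕ) → ∑ (xs ++ ys) f ≡ ∑ xs f + ∑ ys f
  ∑-++ []       ys f = refl
  ∑-++ (x ∷ xs) ys f = trans (cong (f x +_) (∑-++ xs ys f)) (sym (+-assoc (f x) (∑ xs f) (∑ ys f)))

  ∑-pos⇒∃-pos : ∀ xs (f : X → ℕ) → 0 < ∑ xs f → ∃ λ x → 0 < f x
  ∑-pos⇒∃-pos (x ∷ xs) f 0<∑ with f x in fx≡
  ... | suc _ = x , subst (0 <_) (sym fx≡) (s≤s z≤n)
  ... | zero  = ∑-pos⇒∃-pos xs f 0<∑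

  ∑-χ∧ : ∀ (xs : List X) b (p : X → Bool) → ∑[ x ∈ xs ] χ (b ∧ p x) ≡ χ b * ∑[ x ∈ xs ] χ (p x)
  ∑-χ∧ xs b p = trans (∑-cong xs (λ x → χ-∧ b (p x))) (sym (*-distribˡ-∑ (χ b) xs (χ ∘ p)))

  *-distribˡ-∑χ* : ∀ c xs (p : X → Bool) (f : X → ℕ) →
                   c * ∑[ x ∈ xs ] (χ (p x) * f x) ≡ ∑[ x ∈ xs ] (χ (p x) * (c * f x))
  *-distribˡ-∑χ* c xs p f =
    trans (*-distribˡ-∑ c xs _) (∑-cong xs (λ x → x∙yz≈y∙xz *-commutativeSemigroup c (χ (p x)) (f x)))

  ∑χ*-const : ∀ xs (p : X → Bool) c → ∑[ x ∈ xs ] (χ (p x) * c) ≡ c * ∑[ x ∈ xs ] χ (p x)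
  ∑χ*-const xs p c = trans (∑-cong xs (λ x → *-comm (χ (p x)) c)) (sym (*-distribˡ-∑ c xs (χ ∘ p)))

∑-map : ∀ {X Y : Set} xs (g : X → Y) (f : Y → ℕ) → ∑ (map g xs) f ≡ ∑[ x ∈ xs ] f (g x)
∑-map []       g f = refl
∑-map (x ∷ xs) g f = cong (f (g x) +_) (∑-map xs g f)

∑-comm : ∀ {X Y : Set} xs ys (f : X → Y → ℕ) →
         ∑[ x ∈ xs ] ∑[ y ∈ ys ] f x y ≡ ∑[ y ∈ ys ] ∑[ x ∈ xs ] f x y
∑-comm []       ys f = sym (∑-zero ys)
∑-comm (x ∷ xs) ys f = trans (cong (∑ ys (f x) +_) (∑-comm xs ys f)) (sym (∑-distrib-+ ys (f x) _))

Enumerates : {X : Set} → DecidableEquality X → List X → Set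
Enumerates _≟_ xs = ∀ c → ∑[ x ∈ xs ] χ (does (x ≟ c)) ≡ 1

module Enumeration {X : Set} {_≟_ : DecidableEquality X} {xs : List X}
                   (enum : Enumerates _≟_ xs) where

  ∑-δ : ∀ (f : X → ℕ) c → ∑[ x ∈ xs ] (χ (does (x ≟ c)) * f x) ≡ f c
  ∑-δ f c = begin
    ∑[ x ∈ xs ] (χ (does (x ≟ c)) * f x)  ≡⟨ ∑-cong xs δ-comm ⟩
    ∑[ x ∈ xs ] (f c * χ (does (x ≟ c)))  ≡⟨ *-distribˡ-∑ (f c) xs _ ⟨
    f c * ∑[ x ∈ xs ] χ (does (x ≟ c))    ≡⟨ cong (f c *_) (enum c) ⟩
    f c * 1                               ≡⟨ *-identityʳ (f c) ⟩
    f c                                   ∎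
    where
    open ≡-Reasoning
    δ-comm : ∀ x → χ (does (x ≟ c)) * f x ≡ f c * χ (does (x ≟ c))
    δ-comm x with x ≟ c
    ... | yes refl = *-comm 1 (f x)
    ... | no  _    = sym (*-zeroʳ (f c))

  f≤∑f : ∀ (f : X → ℕ) c → f c ≤ ∑ xs f
  f≤∑f f c = begin
    f c                                   ≡⟨ ∑-δ f c ⟨
    ∑[ x ∈ xs ] (χ (does (x ≟ c)) * f x)  ≤⟨ ∑-mono-≤ xs (λ x → *-monoˡ-≤ (f x) (χ-mono {does (x ≟ c)} {true} _)) ⟩
    ∑[ x ∈ xs ] (1 * f x)                 ≡⟨ ∑-cong xs (λ x → *-identityˡ (f x)) ⟩
    ∑ xs f                                ∎
    where open ≤-Reasoning

  ∑-reindex : ∀ (f : X → ℕ) (σ σ⁻¹ : X → X) → (∀ x → σ⁻¹ (σ x) ≡ x) → (∀ y → σ (σ⁻¹ y) ≡ y) →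
              ∑[ x ∈ xs ] f (σ x) ≡ ∑ xs f
  ∑-reindex f σ σ⁻¹ σ⁻¹∘σ σ∘σ⁻¹ = begin
    ∑[ x ∈ xs ] f (σ x)                                    ≡⟨ ∑-cong xs (λ x → ∑-δ f (σ x)) ⟨
    ∑[ x ∈ xs ] ∑[ y ∈ xs ] (χ (does (y ≟ σ x)) * f y)     ≡⟨ ∑-comm xs xs _ ⟩
    ∑[ y ∈ xs ] ∑[ x ∈ xs ] (χ (does (y ≟ σ x)) * f y)     ≡⟨ ∑-cong xs (λ y → ∑-cong xs (λ x → cong (_* f y) (graph-flip x y))) ⟩
    ∑[ y ∈ xs ] ∑[ x ∈ xs ] (χ (does (x ≟ σ⁻¹ y)) * f y)   ≡⟨ ∑-cong xs (λ y → ∑-δ (λ _ → f y) (σ⁻¹ y)) ⟩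
    ∑ xs f                                                 ∎
    where
    open ≡-Reasoning
    graph-flip : ∀ x y → χ (does (y ≟ σ x)) ≡ χ (does (x ≟ σ⁻¹ y))
    graph-flip x y with y ≟ σ x | x ≟ σ⁻¹ y
    ... | yes _    | yes _    = refl
    ... | no  _    | no  _    = refl
    ... | yes refl | no  x≢   = ⊥-elim (x≢ (sym (σ⁻¹∘σ x)))
    ... | no  y≢   | yes refl = ⊥-elim (y≢ (sym (σ∘σ⁻¹ y)))

∑-allFin-suc : ∀ n (f : Fin (suc n) → ℕ) → ∑ (allFin (suc n)) f ≡ f zero + ∑[ i ∈ allFin n ] f (suc i)
∑-allFin-suc n f =
  cong (f zero +_) (trans (cong (λ is → ∑ is f) (sym (map-tabulate id suc))) (∑-map (allFin n) suc f))

allFin-enumerates : ∀ n → Enumerates Fin._≟_ (allFin n)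
allFin-enumerates (suc n) c = trans (∑-allFin-suc n (λ i → χ (does (i Fin.≟ c)))) (count c)
  where
  count : ∀ c → χ (does (zero Fin.≟ c)) + ∑[ i ∈ allFin n ] χ (does (suc i Fin.≟ c)) ≡ 1
  count zero    = cong suc (∑-zero (allFin n))
  count (suc c) = allFin-enumerates n c

_≟ₛ_ : ∀ {n} → DecidableEquality (Subset n)
_≟ₛ_ = Vec.≡-dec Bool._≟_

∑-allSubsets-suc : ∀ n (f : Subset (suc n) → ℕ) →
  ∑ (allSubsets (suc n)) f ≡ ∑[ A ∈ allSubsets n ] f (true ∷ A) + ∑[ A ∈ allSubsets n ] f (false ∷ A)
∑-allSubsets-suc n f = trans (∑-++ (map (true ∷_) (allSubsets n)) _ f)
                             (cong₂ _+_ (∑-map (allSubsets n) _ f) (∑-map (allSubsets n) _ f))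

allSubsets-enumerates : ∀ n → Enumerates _≟ₛ_ (allSubsets n)
allSubsets-enumerates zero    []          = refl
allSubsets-enumerates (suc n) (true  ∷ c) =
  trans (∑-allSubsets-suc n _) (cong₂ _+_ (allSubsets-enumerates n c) (∑-zero (allSubsets n)))
allSubsets-enumerates (suc n) (false ∷ c) =
  trans (∑-allSubsets-suc n _) (cong₂ _+_ (∑-zero (allSubsets n)) (allSubsets-enumerates n c))

module EnumFin {n : ℕ} = Enumeration {_≟_ = Fin._≟_} {xs = allFin n} (allFin-enumerates n)
module EnumSubset {n : ℕ} = Enumeration {_≟_ = _≟ₛ_} {xs = allSubsets n} (allSubsets-enumerates n)

card≡∑χ : ∀ {n} (F : Family n) → card F ≡ ∑[ A ∈ allSubsets n ] χ (F A)
card≡∑χ {n} F = go (allSubsets n)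
  where
  go : ∀ As → length (filter (λ A → T? (F A)) As) ≡ ∑[ A ∈ As ] χ (F A)
  go []       = refl
  go (A ∷ As) with F A
  ... | true  = cong suc (go As)
  ... | false = go As

card-pos : ∀ {n} {F : Family n} {S} → S ∈F F → 0 < card F
card-pos {F = F} {S} S∈F =
  subst (0 <_) (sym (card≡∑χ F)) (≤-trans (χ-mono {true} {F S} (λ _ → S∈F)) (EnumSubset.f≤∑f (χ ∘ F) S))

∃-above-average : ∀ {n} (F : Family n) (f : Subset n → ℕ) K →
                  K < ∑[ S ∈ allSubsets n ] (χ (F S) * f S) → ∃ λ S → S ∈F F × K < card F * f S
∃-above-average {n} F f K K<∑ with anySubset? (λ S → T? (F S) ×-dec K <? card F * f S)
... | yes above = above
... | no  ∄above = ⊥-elim (<-irrefl refl (begin-strict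
  card F * K                             <⟨ *-monoʳ-< (card F) {{>-nonZero F-nonempty}} K<∑ ⟩
  card F * ∑[ S ∈ 𝒫 ] (χ (F S) * f S)    ≡⟨ *-distribˡ-∑χ* (card F) 𝒫 F f ⟩
  ∑[ S ∈ 𝒫 ] (χ (F S) * (card F * f S))  ≤⟨ ∑-mono-≤ 𝒫 (λ S → χ*-mono-≤ (F S) (at-most-average S)) ⟩
  ∑[ S ∈ 𝒫 ] (χ (F S) * K)               ≡⟨ ∑χ*-const 𝒫 F K ⟩
  K * ∑[ S ∈ 𝒫 ] χ (F S)                 ≡⟨ cong (K *_) (card≡∑χ F) ⟨
  K * card F                             ≡⟨ *-comm K (card F) ⟩
  card F * K                             ∎))
  where
  open ≤-Reasoning
  𝒫 : List (Subset n)
  𝒫 = allSubsets n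
  at-most-average : ∀ S → S ∈F F → card F * f S ≤ K
  at-most-average S S∈F = ≮⇒≥ (λ K< → ∄above (S , S∈F , K<))
  F-nonempty : 0 < card F
  F-nonempty with ∑-pos⇒∃-pos 𝒫 (λ S → χ (F S) * f S) (≤-trans (s≤s z≤n) K<∑)
  ... | S , 0<term = card-pos {F = F} (χ*-pos (F S) 0<term)

_choose_ : ∀ {n} → Subset n → ℕ → Family n
(B choose k) S = ⌊ S ⊆? B ⌋ ∧ ⌊ ∣ S ∣ ≟ k ⌋

-- Unlike ⌊_⌋, does computes through the cons cases of _⊆?_ and _≟_.
card-choose : ∀ {n} (B : Subset n) k → card (B choose k) ≡ ∣ B ∣ C k
card-choose {n} B k = begin
  card (B choose k)                                           ≡⟨ card≡∑χ (B choose k) ⟩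
  ∑[ S ∈ allSubsets n ] χ (⌊ S ⊆? B ⌋ ∧ ⌊ ∣ S ∣ ≟ k ⌋)          ≡⟨ ∑-cong (allSubsets n) (λ S → cong χ
                                                                   (cong₂ _∧_ (isYes≗does (S ⊆? B)) (isYes≗does (∣ S ∣ ≟ k)))) ⟩
  ∑[ S ∈ allSubsets n ] χ (does (S ⊆? B) ∧ does (∣ S ∣ ≟ k))  ≡⟨ count B k ⟩
  ∣ B ∣ C k                                                   ∎
  where
  open ≡-Reasoning
  count : ∀ {n} (B : Subset n) k → ∑[ S ∈ allSubsets n ] χ (does (S ⊆? B) ∧ does (∣ S ∣ ≟ k)) ≡ ∣ B ∣ C k
  count []            zero    = refl
  count []            (suc k) = refl
  count {suc n} (inside  ∷ B) zero    = trans (∑-allSubsets-suc n _) (cong₂ _+_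
    (trans (∑-cong (allSubsets n) (λ S → cong χ (∧-zeroʳ (does (S ⊆? B))))) (∑-zero (allSubsets n)))
    (count B zero))
  count {suc n} (inside  ∷ B) (suc k) = trans (∑-allSubsets-suc n _)
    (trans (cong₂ _+_ (count B k) (count B (suc k))) (nCk+nC[k+1]≡[n+1]C[k+1] ∣ B ∣ k))
  count {suc n} (outside ∷ B) k       =
    trans (∑-allSubsets-suc n _) (cong₂ _+_ (∑-zero (allSubsets n)) (count B k))

_∋ᶠ_ : ∀ {n} → Family n → Fin n → Family n
(F ∋ᶠ x) A = F A ∧ lookup A x

_∌ᶠ_ : ∀ {n} → Family n → Fin n → Family n
(F ∌ᶠ x) A = F A ∧ not (lookup A x)

card-∋+∌ : ∀ {n} (F : Family n) x → card (F ∋ᶠ x) + card (F ∌ᶠ x) ≡ card F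
card-∋+∌ {n} F x = begin
  card (F ∋ᶠ x) + card (F ∌ᶠ x)                            ≡⟨ cong₂ _+_ (card≡∑χ (F ∋ᶠ x)) (card≡∑χ (F ∌ᶠ x)) ⟩
  ∑[ A ∈ 𝒫 ] χ ((F ∋ᶠ x) A) + ∑[ A ∈ 𝒫 ] χ ((F ∌ᶠ x) A)    ≡⟨ ∑-distrib-+ 𝒫 _ _ ⟨
  ∑[ A ∈ 𝒫 ] (χ ((F ∋ᶠ x) A) + χ ((F ∌ᶠ x) A))             ≡⟨ ∑-cong 𝒫 split ⟩
  ∑[ A ∈ 𝒫 ] χ (F A)                                       ≡⟨ card≡∑χ F ⟨
  card F                                                   ∎
  where
  open ≡-Reasoning
  𝒫 : List (Subset n)
  𝒫 = allSubsets n
  split : ∀ A → χ ((F ∋ᶠ x) A) + χ ((F ∌ᶠ x) A) ≡ χ (F A)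
  split A with F A | lookup A x
  ... | true  | true  = refl
  ... | true  | false = refl
  ... | false | _     = refl

uniformContaining⁻ : ∀ {n} {H : Family n} {r S A} →
                     A ∈F uniformContaining H r S → A ∈F H × ∣ A ∣ ≡ r × S ⊆ A
uniformContaining⁻ {H = H} {r} {S} {A} A∈ with T-∧⁻ (H A) A∈
... | A∈H , size∧sub with T-∧⁻ ⌊ ∣ A ∣ ≟ r ⌋ size∧sub
...   | ∣A∣≡r , S⊆A = A∈H , toWitness {a? = ∣ A ∣ ≟ r} ∣A∣≡r , toWitness {a? = S ⊆? A} S⊆A

uniformContaining⁺ : ∀ {n} {H : Family n} {r S A} →
                     A ∈F H → ∣ A ∣ ≡ r → S ⊆ A → A ∈F uniformContaining H r S
uniformContaining⁺ {H = H} {r} {S} {A} A∈H ∣A∣≡r S⊆A =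
  T-∧⁺ (H A) A∈H (T-∧⁺ ⌊ ∣ A ∣ ≟ r ⌋ (fromWitness {a? = ∣ A ∣ ≟ r} ∣A∣≡r) (fromWitness {a? = S ⊆? A} S⊆A))

∣p∣≡∑χ : ∀ {n} (p : Subset n) → ∣ p ∣ ≡ ∑[ i ∈ allFin n ] χ (lookup p i)
∣p∣≡∑χ []                  = refl
∣p∣≡∑χ {suc n} (true  ∷ p) = trans (cong suc (∣p∣≡∑χ p)) (sym (∑-allFin-suc n (χ ∘ lookup (true ∷ p))))
∣p∣≡∑χ {suc n} (false ∷ p) = trans (∣p∣≡∑χ p) (sym (∑-allFin-suc n (χ ∘ lookup (false ∷ p))))

∈⇒lookup : ∀ {n} {x : Fin n} {p : Subset n} → x ∈ p → T (lookup p x)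
∈⇒lookup x∈p = subst T (sym (Vec.[]=⇒lookup x∈p)) tt

lookup⇒∈ : ∀ {n} {x : Fin n} {p : Subset n} → T (lookup p x) → x ∈ p
lookup⇒∈ {x = x} {p} px = Vec.lookup⇒[]= x p (Equivalence.to T-≡ px)

∉⇒T-not : ∀ {n} {x : Fin n} {p : Subset n} → x ∉ p → T (not (lookup p x))
∉⇒T-not {x = x} {p} x∉p with lookup p x in px
... | true  = x∉p (lookup⇒∈ (subst T (sym px) tt))
... | false = tt

T-not⇒∉ : ∀ {n} {x : Fin n} {p : Subset n} → T (not (lookup p x)) → x ∉ p
T-not⇒∉ {x = x} {p} ¬px x∈p with lookup p x | ∈⇒lookup x∈p
... | true | _ = ¬px

lookup-─ : ∀ {n} (p q : Subset n) i → lookup (p ─ q) i ≡ lookup p i ∧ not (lookup q i)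
lookup-─ (b ∷ p) (inside  ∷ q) zero    = sym (∧-zeroʳ b)
lookup-─ (b ∷ p) (outside ∷ q) zero    = sym (∧-identityʳ b)
lookup-─ (_ ∷ p) (_       ∷ q) (suc i) = lookup-─ p q i

∣p─q∣≡∑χ : ∀ {n} (p q : Subset n) → ∣ p ─ q ∣ ≡ ∑[ i ∈ allFin n ] χ (lookup p i ∧ not (lookup q i))
∣p─q∣≡∑χ {n} p q = trans (∣p∣≡∑χ (p ─ q)) (∑-cong (allFin n) (cong χ ∘ lookup-─ p q))

⊈⇒∃∈∉ : ∀ {n} {p q : Subset n} → ¬ p ⊆ q → ∃ λ x → x ∈ p × x ∉ q
⊈⇒∃∈∉ {p = p} {q} p⊈q with Fin.any? (λ x → x ∈? p ×-dec ¬? (x ∈? q))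
... | yes witness = witness
... | no  none    = ⊥-elim (p⊈q λ {x} x∈p → decidable-stable (x ∈? q) (λ x∉q → none (x , x∈p , x∉q)))

⊆∧∣∣≤⇒≡ : ∀ {n} {p q : Subset n} → p ⊆ q → ∣ q ∣ ≤ ∣ p ∣ → p ≡ q
⊆∧∣∣≤⇒≡ {p = p} p⊆q ∣q∣≤∣p∣ = ⊆-antisym p⊆q λ {x} x∈q →
  decidable-stable (x ∈? p) (λ x∉p → <⇒≱ (p⊂q⇒∣p∣<∣q∣ (p⊆q , x , x∈q , x∉p)) ∣q∣≤∣p∣)

∃⊆-ofSize : ∀ {n} (p : Subset n) k → k ≤ ∣ p ∣ → ∃ λ q → q ⊆ p × ∣ q ∣ ≡ k
∃⊆-ofSize {n} p         zero    _           = ⊥ , ⊆-min p , ∣⊥∣≡0 n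
∃⊆-ofSize (inside  ∷ p) (suc k) (s≤s k≤∣p∣) with ∃⊆-ofSize p k k≤∣p∣
... | q , q⊆p , ∣q∣≡k = inside ∷ q , s⊆s q⊆p , cong suc ∣q∣≡k
∃⊆-ofSize (outside ∷ p) (suc k) k<∣p∣       with ∃⊆-ofSize p (suc k) k<∣p∣
... | q , q⊆p , ∣q∣≡k = outside ∷ q , out⊆ q⊆p , ∣q∣≡k

∣p∣≤∣p─q∣+∣q∣ : ∀ {n} (p q : Subset n) → ∣ p ∣ ≤ ∣ p ─ q ∣ + ∣ q ∣
∣p∣≤∣p─q∣+∣q∣ []            []            = z≤n
∣p∣≤∣p─q∣+∣q∣ (inside  ∷ p) (outside ∷ q) = s≤s (∣p∣≤∣p─q∣+∣q∣ p q)
∣p∣≤∣p─q∣+∣q∣ (outside ∷ p) (outside ∷ q) = ∣p∣≤∣p─q∣+∣q∣ p q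
∣p∣≤∣p─q∣+∣q∣ (inside  ∷ p) (inside  ∷ q) =
  subst (suc ∣ p ∣ ≤_) (sym (+-suc ∣ p ─ q ∣ ∣ q ∣)) (s≤s (∣p∣≤∣p─q∣+∣q∣ p q))
∣p∣≤∣p─q∣+∣q∣ (outside ∷ p) (inside  ∷ q) =
  subst (∣ p ∣ ≤_) (sym (+-suc ∣ p ─ q ∣ ∣ q ∣)) (m≤n⇒m≤1+n (∣p∣≤∣p─q∣+∣q∣ p q))

∣p─q∣+∣q∣≡∣p∣ : ∀ {n} {p q : Subset n} → q ⊆ p → ∣ p ─ q ∣ + ∣ q ∣ ≡ ∣ p ∣
∣p─q∣+∣q∣≡∣p∣ {p = []}          {[]}          _   = refl
∣p─q∣+∣q∣≡∣p∣ {p = inside  ∷ p} {outside ∷ q} q⊆p = cong suc (∣p─q∣+∣q∣≡∣p∣ (drop-∷-⊆ q⊆p))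
∣p─q∣+∣q∣≡∣p∣ {p = outside ∷ p} {outside ∷ q} q⊆p = ∣p─q∣+∣q∣≡∣p∣ (drop-∷-⊆ q⊆p)
∣p─q∣+∣q∣≡∣p∣ {p = inside  ∷ p} {inside  ∷ q} q⊆p =
  trans (+-suc ∣ p ─ q ∣ ∣ q ∣) (cong suc (∣p─q∣+∣q∣≡∣p∣ (drop-∷-⊆ q⊆p)))
∣p─q∣+∣q∣≡∣p∣ {p = outside ∷ p} {inside  ∷ q} q⊆p with () ← q⊆p here

module _ {n} (F : Family n) where

  private
    extend : ∀ k X → X ∈F F → n ≤ k + ∣ X ∣ → ∃ λ D → IsBase F D × X ⊆ D
    extend k X X∈F n≤k+∣X∣ with anySubset? (λ Y → T? (F Y) ×-dec X ⊆? Y ×-dec ∣ X ∣ <? ∣ Y ∣) | k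
    ... | no ∄larger | _ = X , (X∈F , maximal) , ⊆-refl
      where
      maximal : ∀ A → A ∈F F → X ⊆ A → X ≡ A
      maximal A A∈F X⊆A = ⊆∧∣∣≤⇒≡ X⊆A (≮⇒≥ λ ∣X∣<∣A∣ → ∄larger (A , A∈F , X⊆A , ∣X∣<∣A∣))
    ... | yes (Y , _ , _ , ∣X∣<∣Y∣) | zero = ⊥-elim (<⇒≱ (≤-trans ∣X∣<∣Y∣ (∣p∣≤n Y)) n≤k+∣X∣)
    ... | yes (Y , Y∈F , X⊆Y , ∣X∣<∣Y∣) | suc k
      with extend k Y Y∈F (≤-trans n≤k+∣X∣ (≤-trans (≤-reflexive (sym (+-suc k ∣ X ∣))) (+-monoʳ-≤ k ∣X∣<∣Y∣)))
    ...   | D , D-base , Y⊆D = D , D-base , ⊆-trans X⊆Y Y⊆D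

  ⊆-base : ∀ X → X ∈F F → ∃ λ D → IsBase F D × X ⊆ D
  ⊆-base X X∈F = extend n X X∈F (m≤m+n n ∣ X ∣)

-- Exchanging one element of a set

transpose-matchˡ : ∀ {n} (i j : Fin n) → transpose i j i ≡ j
transpose-matchˡ i j rewrite dec-true (i Fin.≟ i) refl = refl

transpose-matchʳ : ∀ {n} (i j : Fin n) → transpose i j j ≡ i
transpose-matchʳ i j with j Fin.≟ i
... | yes j≡i = j≡i
... | no  _   rewrite dec-true (j Fin.≟ j) refl = refl

transpose-other : ∀ {n} {i j k : Fin n} → k ≢ i → k ≢ j → transpose i j k ≡ k
transpose-other {i = i} {j} {k} k≢i k≢j with k Fin.≟ i
... | yes k≡i = ⊥-elim (k≢i k≡i)
... | no  _   with k Fin.≟ j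
...   | yes k≡j = ⊥-elim (k≢j k≡j)
...   | no  _   = refl

-- For x ∈ p and y ∉ p this is p − x + y; defining it by permuting coordinates makes it a
-- bijection of Subset n.
swap : ∀ {n} → Fin n → Fin n → Subset n → Subset n
swap x y p = Vec.tabulate (lookup p ∘ transpose x y)

lookup-swap : ∀ {n} (x y : Fin n) p i → lookup (swap x y p) i ≡ lookup p (transpose x y i)
lookup-swap x y p = Vec.lookup∘tabulate (lookup p ∘ transpose x y)

∈-swap⁻ : ∀ {n} {x y i : Fin n} {p} → i ∈ swap x y p → transpose x y i ∈ p
∈-swap⁻ {x = x} {y} {i} {p} i∈ = lookup⇒∈ (subst T (lookup-swap x y p i) (∈⇒lookup i∈))

∈-swap⁺ : ∀ {n} {x y i : Fin n} {p} → transpose x y i ∈ p → i ∈ swap x y p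
∈-swap⁺ {x = x} {y} {i} {p} ∈p = lookup⇒∈ (subst T (sym (lookup-swap x y p i)) (∈⇒lookup ∈p))

swap-inverse : ∀ {n} (x y : Fin n) p → swap x y (swap y x p) ≡ p
swap-inverse x y p = begin
  swap x y (swap y x p)    ≡⟨ Vec.tabulate-cong (λ i → trans (lookup-swap y x p _) (cong (lookup p) (transpose-inverse y x))) ⟩
  Vec.tabulate (lookup p)  ≡⟨ Vec.tabulate∘lookup p ⟩
  p                        ∎
  where open ≡-Reasoning

∣swap∣ : ∀ {n} (x y : Fin n) p → ∣ swap x y p ∣ ≡ ∣ p ∣
∣swap∣ {n} x y p = begin
  ∣ swap x y p ∣                                    ≡⟨ ∣p∣≡∑χ (swap x y p) ⟩
  ∑[ i ∈ allFin n ] χ (lookup (swap x y p) i)       ≡⟨ ∑-cong (allFin n) (cong χ ∘ lookup-swap x y p) ⟩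
  ∑[ i ∈ allFin n ] χ (lookup p (transpose x y i))  ≡⟨ EnumFin.∑-reindex (χ ∘ lookup p) (transpose x y) (transpose y x)
                                                         (λ _ → transpose-inverse y x) (λ _ → transpose-inverse x y) ⟩
  ∑[ i ∈ allFin n ] χ (lookup p i)                  ≡⟨ ∣p∣≡∑χ p ⟨
  ∣ p ∣                                             ∎
  where open ≡-Reasoning

-- The shifting inequality

suc*≤*+ : ∀ {a b h q} → a * h ≤ b * q → (0 < h → 0 < b) → suc a * h ≤ b * (h + q)
suc*≤*+ {a} {b} {zero}  {q} _     _       = ≤-trans (≤-reflexive (*-zeroʳ (suc a))) z≤n
suc*≤*+ {a} {b} {suc h} {q} ah≤bq h>0⇒b>0 = begin
  suc h + a * suc h  ≤⟨ +-mono-≤ (m≤n*m (suc h) b {{>-nonZero (h>0⇒b>0 (s≤s z≤n))}}) ah≤bq ⟩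
  b * suc h + b * q  ≡⟨ *-distribˡ-+ b (suc h) q ⟨
  b * (suc h + q)    ∎
  where open ≤-Reasoning

module Shifting {n} {H : Family n} (hereditary : Hereditary H)
                {m} (bases-large : ∀ B → IsBase H B → m ≤ ∣ B ∣) (r : ℕ) where

  H⟨_⟩ : Subset n → Family n
  H⟨ S ⟩ = uniformContaining H r S

  swaps-into-H : ∀ {A x} → A ∈F H → ∣ A ∣ ≡ r → x ∈ A →
                 m ∸ r ≤ ∑[ y ∈ allFin n ] χ (not (lookup A y) ∧ H (swap x y A))
  swaps-into-H {A} {x} A∈H ∣A∣≡r x∈A = begin
    m ∸ r                                                    ≤⟨ m≤n+o⇒m∸n≤o m r m≤r+∣D─A∣ ⟩
    ∣ D ─ A ∣                                                ≡⟨ ∣p─q∣≡∑χ D A ⟩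
    ∑[ y ∈ allFin n ] χ (lookup D y ∧ not (lookup A y))      ≤⟨ ∑-mono-≤ (allFin n) (λ y → χ-mono (swap-stays-in-H y)) ⟩
    ∑[ y ∈ allFin n ] χ (not (lookup A y) ∧ H (swap x y A))  ∎
    where
    open ≤-Reasoning
    base : ∃ λ D → IsBase H D × A - x ⊆ D
    base = ⊆-base H (A - x) (hereditary A (A - x) A∈H (p─q⊆p A _))
    D : Subset n
    D = proj₁ base
    D-base : IsBase H D
    D-base = proj₁ (proj₂ base)
    A-x⊆D : A - x ⊆ D
    A-x⊆D = proj₂ (proj₂ base)
    m≤r+∣D─A∣ : m ≤ r + ∣ D ─ A ∣
    m≤r+∣D─A∣ = ≤-trans (bases-large D D-base) (≤-trans (∣p∣≤∣p─q∣+∣q∣ D A)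
                  (≤-reflexive (trans (cong (∣ D ─ A ∣ +_) ∣A∣≡r) (+-comm ∣ D ─ A ∣ r))))
    swap⊆D : ∀ {y} → y ∈ D → y ∉ A → swap x y A ⊆ D
    swap⊆D {y} y∈D y∉A {i} i∈swap with i Fin.≟ x | i Fin.≟ y
    ... | yes refl | _        = ⊥-elim (y∉A (subst (_∈ A) (transpose-matchˡ i y) (∈-swap⁻ i∈swap)))
    ... | no  _    | yes refl = y∈D
    ... | no  i≢x  | no  i≢y  =
      A-x⊆D (x∈p∧x≢y⇒x∈p-y (subst (_∈ A) (transpose-other i≢x i≢y) (∈-swap⁻ i∈swap)) i≢x)
    swap-stays-in-H : ∀ y → T (lookup D y ∧ not (lookup A y)) → T (not (lookup A y) ∧ H (swap x y A))
    swap-stays-in-H y Dy∧¬Ay with T-∧⁻ (lookup D y) Dy∧¬Ay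
    ... | Dy , ¬Ay = T-∧⁺ (not (lookup A y)) ¬Ay
                       (hereditary D _ (proj₁ D-base) (swap⊆D (lookup⇒∈ Dy) (T-not⇒∉ ¬Ay)))

  exchangeable : Subset n → Fin n → Fin n → Family n
  exchangeable S x y A = (H⟨ S ⟩ ∋ᶠ x) A ∧ (not (lookup A y) ∧ H (swap x y A))

  exchange-back : ∀ {S x y} A → x ∉ S → T (exchangeable S x y (swap y x A)) →
                  T ((H⟨ S ⟩ ∌ᶠ x) A ∧ (lookup A y ∧ not (lookup S y)))
  exchange-back {S} {x} {y} A x∉S exch with T-∧⁻ ((H⟨ S ⟩ ∋ᶠ x) (swap y x A)) exch
  ... | B∈∧x∈B , y∉B∧H with T-∧⁻ (H⟨ S ⟩ (swap y x A)) B∈∧x∈B | T-∧⁻ (not (lookup (swap y x A) y)) y∉B∧H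
  ...   | B∈ , x∈B | y∉B , H-swapped with uniformContaining⁻ {H = H} B∈
  ...     | _ , ∣B∣≡r , S⊆B =
    T-∧⁺ ((H⟨ S ⟩ ∌ᶠ x) A) (T-∧⁺ (H⟨ S ⟩ A) (uniformContaining⁺ {H = H} A∈H ∣A∣≡r S⊆A) (∉⇒T-not x∉A))
                            (T-∧⁺ (lookup A y) (∈⇒lookup y∈A) (∉⇒T-not y∉S))
    where
    A∈H : A ∈F H
    A∈H = subst (λ Z → T (H Z)) (swap-inverse x y A) H-swapped
    ∣A∣≡r : ∣ A ∣ ≡ r
    ∣A∣≡r = trans (sym (∣swap∣ y x A)) ∣B∣≡r
    y∈A : y ∈ A
    y∈A = subst (_∈ A) (transpose-matchʳ y x) (∈-swap⁻ (lookup⇒∈ x∈B))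
    x∉A : x ∉ A
    x∉A x∈A = T-not⇒∉ y∉B (∈-swap⁺ (subst (_∈ A) (sym (transpose-matchˡ y x)) x∈A))
    y∉S : y ∉ S
    y∉S = T-not⇒∉ y∉B ∘ S⊆B
    S⊆A : S ⊆ A
    S⊆A {i} i∈S =
      subst (_∈ A) (transpose-other (λ { refl → y∉S i∈S }) (λ { refl → x∉S i∈S })) (∈-swap⁻ (S⊆B i∈S))

  shift-inequality : ∀ {S x} → x ∉ S → (m ∸ r) * card (H⟨ S ⟩ ∋ᶠ x) ≤ (r ∸ ∣ S ∣) * card (H⟨ S ⟩ ∌ᶠ x)
  shift-inequality {S} {x} x∉S = begin
    (m ∸ r) * card P                                         ≡⟨ cong ((m ∸ r) *_) (card≡∑χ P) ⟩
    (m ∸ r) * ∑[ A ∈ 𝒫 ] χ (P A)                              ≡⟨ *-distribˡ-∑ (m ∸ r) 𝒫 _ ⟩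
    ∑[ A ∈ 𝒫 ] ((m ∸ r) * χ (P A))                            ≤⟨ ∑-mono-≤ 𝒫 many-exchanges ⟩
    ∑[ A ∈ 𝒫 ] ∑[ y ∈ allFin n ] χ (exchangeable S x y A)     ≡⟨ ∑-comm 𝒫 (allFin n) _ ⟩
    ∑[ y ∈ allFin n ] ∑[ A ∈ 𝒫 ] χ (exchangeable S x y A)     ≡⟨ ∑-cong (allFin n) (λ y →
                                                                 EnumSubset.∑-reindex (χ ∘ exchangeable S x y) (swap y x) (swap x y)
                                                                   (swap-inverse x y) (swap-inverse y x)) ⟨
    ∑[ y ∈ allFin n ] ∑[ A ∈ 𝒫 ] χ (exchangeable S x y (swap y x A))
                                                             ≤⟨ ∑-mono-≤ (allFin n) (λ y → ∑-mono-≤ 𝒫 λ A →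
                                                                 χ-mono (exchange-back A x∉S)) ⟩
    ∑[ y ∈ allFin n ] ∑[ A ∈ 𝒫 ] χ (Q A ∧ (lookup A y ∧ not (lookup S y)))
                                                             ≡⟨ ∑-comm (allFin n) 𝒫 _ ⟩
    ∑[ A ∈ 𝒫 ] ∑[ y ∈ allFin n ] χ (Q A ∧ (lookup A y ∧ not (lookup S y)))
                                                             ≤⟨ ∑-mono-≤ 𝒫 few-exchanges ⟩
    ∑[ A ∈ 𝒫 ] ((r ∸ ∣ S ∣) * χ (Q A))                        ≡⟨ *-distribˡ-∑ (r ∸ ∣ S ∣) 𝒫 _ ⟨
    (r ∸ ∣ S ∣) * ∑[ A ∈ 𝒫 ] χ (Q A)                          ≡⟨ cong ((r ∸ ∣ S ∣) *_) (card≡∑χ Q) ⟨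
    (r ∸ ∣ S ∣) * card Q                                      ∎
    where
    open ≤-Reasoning
    𝒫 : List (Subset n)
    𝒫 = allSubsets n
    P : Family n
    P = H⟨ S ⟩ ∋ᶠ x
    Q : Family n
    Q = H⟨ S ⟩ ∌ᶠ x
    many-exchanges : ∀ A → (m ∸ r) * χ (P A) ≤ ∑[ y ∈ allFin n ] χ (exchangeable S x y A)
    many-exchanges A = begin
      (m ∸ r) * χ (P A)                                                ≡⟨ *-comm (m ∸ r) (χ (P A)) ⟩
      χ (P A) * (m ∸ r)                                                ≤⟨ χ*-mono-≤ (P A) lower ⟩
      χ (P A) * ∑[ y ∈ allFin n ] χ (not (lookup A y) ∧ H (swap x y A))  ≡⟨ ∑-χ∧ (allFin n) (P A) _ ⟨
      ∑[ y ∈ allFin n ] χ (exchangeable S x y A)                       ∎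
      where
      lower : T (P A) → m ∸ r ≤ ∑[ y ∈ allFin n ] χ (not (lookup A y) ∧ H (swap x y A))
      lower A∈P with T-∧⁻ (H⟨ S ⟩ A) A∈P
      ... | A∈ , x∈A with uniformContaining⁻ {H = H} A∈
      ...   | A∈H , ∣A∣≡r , _ = swaps-into-H A∈H ∣A∣≡r (lookup⇒∈ x∈A)
    few-exchanges : ∀ A → ∑[ y ∈ allFin n ] χ (Q A ∧ (lookup A y ∧ not (lookup S y))) ≤ (r ∸ ∣ S ∣) * χ (Q A)
    few-exchanges A = begin
      ∑[ y ∈ allFin n ] χ (Q A ∧ (lookup A y ∧ not (lookup S y)))    ≡⟨ ∑-χ∧ (allFin n) (Q A) _ ⟩
      χ (Q A) * ∑[ y ∈ allFin n ] χ (lookup A y ∧ not (lookup S y))  ≡⟨ cong (χ (Q A) *_) (∣p─q∣≡∑χ A S) ⟨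
      χ (Q A) * ∣ A ─ S ∣                                            ≤⟨ χ*-mono-≤ (Q A) upper ⟩
      χ (Q A) * (r ∸ ∣ S ∣)                                          ≡⟨ *-comm (χ (Q A)) (r ∸ ∣ S ∣) ⟩
      (r ∸ ∣ S ∣) * χ (Q A)                                          ∎
      where
      upper : T (Q A) → ∣ A ─ S ∣ ≤ r ∸ ∣ S ∣
      upper A∈Q with uniformContaining⁻ {H = H} (proj₁ (T-∧⁻ (H⟨ S ⟩ A) A∈Q))
      ... | _ , ∣A∣≡r , S⊆A = ≤-reflexive (begin-equality
        ∣ A ─ S ∣                  ≡⟨ m+n∸n≡m ∣ A ─ S ∣ ∣ S ∣ ⟨
        ∣ A ─ S ∣ + ∣ S ∣ ∸ ∣ S ∣  ≡⟨ cong (_∸ ∣ S ∣) (trans (∣p─q∣+∣q∣≡∣p∣ S⊆A) ∣A∣≡r) ⟩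
        r ∸ ∣ S ∣                  ∎)

  ∋-nonempty⇒∣S∣<r : ∀ {S x} → x ∉ S → 0 < card (H⟨ S ⟩ ∋ᶠ x) → ∣ S ∣ < r
  ∋-nonempty⇒∣S∣<r {S} {x} x∉S 0<card
    with ∑-pos⇒∃-pos (allSubsets n) (χ ∘ (H⟨ S ⟩ ∋ᶠ x)) (subst (0 <_) (card≡∑χ (H⟨ S ⟩ ∋ᶠ x)) 0<card)
  ... | A , 0<χ with T-∧⁻ (H⟨ S ⟩ A) (χ-pos 0<χ)
  ...   | A∈ , x∈A with uniformContaining⁻ {H = H} A∈
  ...     | _ , ∣A∣≡r , S⊆A = subst (∣ S ∣ <_) ∣A∣≡r (p⊂q⇒∣p∣<∣q∣ (S⊆A , x , lookup⇒∈ x∈A , x∉S))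

  shift-bound : ∀ {S x} → x ∉ S → suc (m ∸ r) * card (H⟨ S ⟩ ∋ᶠ x) ≤ (r ∸ ∣ S ∣) * card H⟨ S ⟩
  shift-bound {S} {x} x∉S =
    subst ((suc (m ∸ r) * card (H⟨ S ⟩ ∋ᶠ x) ≤_) ∘ ((r ∸ ∣ S ∣) *_)) (card-∋+∌ H⟨ S ⟩ x)
      (suc*≤*+ {a = m ∸ r} (shift-inequality x∉S) (m<n⇒0<n∸m ∘ ∋-nonempty⇒∣S∣<r x∉S))

-- Covering 𝒜 by the families ℋ⁽ʳ⁾(T ∪ {x})

common-subset⇒trivial : ∀ {n t} {ℬ : Family n} {S} →
                        t ≤ ∣ S ∣ → (∀ B → B ∈F ℬ → S ⊆ B) → TrivialTIntersecting t ℬ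
common-subset⇒trivial {S = S} t≤∣S∣ S⊆ℬ =
  (λ X Y X∈ℬ Y∈ℬ → ≤-trans t≤∣S∣ (p⊆q⇒∣p∣≤∣q∣ λ x∈S → x∈p∩q⁺ (S⊆ℬ X X∈ℬ x∈S , S⊆ℬ Y Y∈ℬ x∈S))) ,
  S , t≤∣S∣ , S⊆ℬ

escapeFrom : ∀ {n} → Family n → Subset n → Subset n
escapeFrom ℬ S with anySubset? (λ B → T? (ℬ B) ×-dec ¬? (S ⊆? B))
... | yes (B , _) = B
... | no  _       = S  -- junk value, not reached when t ≤ ∣ S ∣ and ℬ is not trivial (escapeFrom-spec)

escapeFrom-spec : ∀ {n t} {ℬ : Family n} {S} → ¬ TrivialTIntersecting t ℬ → t ≤ ∣ S ∣ →
                  escapeFrom ℬ S ∈F ℬ × ¬ S ⊆ escapeFrom ℬ S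
escapeFrom-spec {ℬ = ℬ} {S} nontrivial t≤∣S∣ with anySubset? (λ B → T? (ℬ B) ×-dec ¬? (S ⊆? B))
... | yes (_ , escapes) = escapes
... | no  ∄escape       = ⊥-elim (nontrivial (common-subset⇒trivial t≤∣S∣ λ B B∈ℬ →
                            decidable-stable (S ⊆? B) (λ S⊈B → ∄escape (B , B∈ℬ , S⊈B))))

module Covering {n} {t r s m : ℕ} {H 𝒜 ℬ : Family n}
  (hereditary : Hereditary H) (bases-large : ∀ B → IsBase H B → m ≤ ∣ B ∣)
  (𝒜⊆H : 𝒜 ⊆F H) (𝒜-uniform : Uniform r 𝒜) (ℬ-uniform : Uniform s ℬ) (cross : CrossIntersecting t 𝒜 ℬ)
  {B₀} (B₀∈ℬ : B₀ ∈F ℬ)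
  (B⟨_⟩ : Subset n → Subset n) (escapes : ∀ S → ∣ S ∣ ≡ t → B⟨ S ⟩ ∈F ℬ × ¬ S ⊆ B⟨ S ⟩) where

  open Shifting hereditary bases-large r using (H⟨_⟩; shift-bound)

  𝒫 : List (Subset n)
  𝒫 = allSubsets n

  𝒯 : Family n
  𝒯 = B₀ choose t

  𝒯⁻ : ∀ {S} → S ∈F 𝒯 → S ⊆ B₀ × ∣ S ∣ ≡ t
  𝒯⁻ {S} S∈𝒯 with T-∧⁻ ⌊ S ⊆? B₀ ⌋ S∈𝒯
  ... | S⊆B₀ , ∣S∣≡t = toWitness {a? = S ⊆? B₀} S⊆B₀ , toWitness {a? = ∣ S ∣ ≟ t} ∣S∣≡t

  𝒯⁺ : ∀ {S} → S ⊆ B₀ → ∣ S ∣ ≡ t → S ∈F 𝒯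
  𝒯⁺ {S} S⊆B₀ ∣S∣≡t = T-∧⁺ ⌊ S ⊆? B₀ ⌋ (fromWitness {a? = S ⊆? B₀} S⊆B₀) (fromWitness {a? = ∣ S ∣ ≟ t} ∣S∣≡t)

  covers : Subset n → Fin n → Subset n → Bool
  covers S x A = 𝒯 S ∧ (lookup (B⟨ S ⟩ ─ S) x ∧ (H⟨ S ⟩ ∋ᶠ x) A)

  weight : Subset n → ℕ
  weight S = ∑[ x ∈ allFin n ] (χ (lookup (B⟨ S ⟩ ─ S) x) * card (H⟨ S ⟩ ∋ᶠ x))

  ∃-cover : ∀ {A} → A ∈F 𝒜 → ∃ λ S → ∃ λ x → T (covers S x A)
  ∃-cover {A} A∈𝒜 = S , x ,
    T-∧⁺ (𝒯 S) (𝒯⁺ (p∩q⊆q A B₀ ∘ S⊆A∩B₀) ∣S∣≡t)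
      (T-∧⁺ (lookup (B ─ S) x) (∈⇒lookup (x∈p∧x∉q⇒x∈p─q x∈B x∉S))
        (T-∧⁺ (H⟨ S ⟩ A) (uniformContaining⁺ {H = H} (𝒜⊆H A A∈𝒜) (𝒜-uniform A A∈𝒜) (p∩q⊆p A B₀ ∘ S⊆A∩B₀))
          (∈⇒lookup x∈A)))
    where
    picked : ∃ λ S → S ⊆ A ∩ B₀ × ∣ S ∣ ≡ t
    picked = ∃⊆-ofSize (A ∩ B₀) t (cross A B₀ A∈𝒜 B₀∈ℬ)
    S : Subset n
    S = proj₁ picked
    S⊆A∩B₀ : S ⊆ A ∩ B₀
    S⊆A∩B₀ = proj₁ (proj₂ picked)
    ∣S∣≡t : ∣ S ∣ ≡ t
    ∣S∣≡t = proj₂ (proj₂ picked)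
    B : Subset n
    B = B⟨ S ⟩
    A∩B⊈S : ¬ A ∩ B ⊆ S
    A∩B⊈S A∩B⊆S = proj₂ (escapes S ∣S∣≡t) (subst (_⊆ B) A∩B≡S (p∩q⊆q A B))
      where
      A∩B≡S : A ∩ B ≡ S
      A∩B≡S = ⊆∧∣∣≤⇒≡ A∩B⊆S (subst (_≤ ∣ A ∩ B ∣) (sym ∣S∣≡t) (cross A B A∈𝒜 (proj₁ (escapes S ∣S∣≡t))))
    witness : ∃ λ x → x ∈ A ∩ B × x ∉ S
    witness = ⊈⇒∃∈∉ A∩B⊈S
    x : Fin n
    x = proj₁ witness
    x∉S : x ∉ S
    x∉S = proj₂ (proj₂ witness)
    x∈A : x ∈ A
    x∈A = proj₁ (x∈p∩q⁻ A B (proj₁ (proj₂ witness)))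
    x∈B : x ∈ B
    x∈B = proj₂ (x∈p∩q⁻ A B (proj₁ (proj₂ witness)))

  card≤∑weight : card 𝒜 ≤ ∑[ S ∈ 𝒫 ] (χ (𝒯 S) * weight S)
  card≤∑weight = begin
    card 𝒜                                                     ≡⟨ card≡∑χ 𝒜 ⟩
    ∑[ A ∈ 𝒫 ] χ (𝒜 A)                                         ≤⟨ ∑-mono-≤ 𝒫 covered ⟩
    ∑[ A ∈ 𝒫 ] ∑[ S ∈ 𝒫 ] ∑[ x ∈ allFin n ] χ (covers S x A)   ≡⟨ ∑-comm 𝒫 𝒫 _ ⟩
    ∑[ S ∈ 𝒫 ] ∑[ A ∈ 𝒫 ] ∑[ x ∈ allFin n ] χ (covers S x A)   ≡⟨ ∑-cong 𝒫 (λ S → ∑-comm 𝒫 (allFin n) _) ⟩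
    ∑[ S ∈ 𝒫 ] ∑[ x ∈ allFin n ] ∑[ A ∈ 𝒫 ] χ (covers S x A)   ≡⟨ ∑-cong 𝒫 regroup ⟩
    ∑[ S ∈ 𝒫 ] (χ (𝒯 S) * weight S)                            ∎
    where
    open ≤-Reasoning
    covered : ∀ A → χ (𝒜 A) ≤ ∑[ S ∈ 𝒫 ] ∑[ x ∈ allFin n ] χ (covers S x A)
    covered A = χ≤ (𝒜 A) λ A∈𝒜 → let (S , x , cover) = ∃-cover A∈𝒜 in
      ≤-trans (χ-mono {true} {covers S x A} (λ _ → cover))
        (≤-trans (EnumFin.f≤∑f (λ x → χ (covers S x A)) x)
                 (EnumSubset.f≤∑f (λ S → ∑[ x ∈ allFin n ] χ (covers S x A)) S))
    regroup : ∀ S → ∑[ x ∈ allFin n ] ∑[ A ∈ 𝒫 ] χ (covers S x A) ≡ χ (𝒯 S) * weight S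
    regroup S = begin-equality
      ∑[ x ∈ allFin n ] ∑[ A ∈ 𝒫 ] χ (covers S x A)        ≡⟨ ∑-cong (allFin n) (λ x → ∑-χ∧ 𝒫 (𝒯 S) _) ⟩
      ∑[ x ∈ allFin n ] (χ (𝒯 S) * ∑[ A ∈ 𝒫 ] χ (c x A))   ≡⟨ *-distribˡ-∑ (χ (𝒯 S)) (allFin n) _ ⟨
      χ (𝒯 S) * ∑[ x ∈ allFin n ] ∑[ A ∈ 𝒫 ] χ (c x A)     ≡⟨ cong (χ (𝒯 S) *_) (∑-cong (allFin n) λ x →
                                                              trans (∑-χ∧ 𝒫 (lookup (B⟨ S ⟩ ─ S) x) _)
                                                                    (cong (χ (lookup (B⟨ S ⟩ ─ S) x) *_) (sym (card≡∑χ (H⟨ S ⟩ ∋ᶠ x))))) ⟩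
      χ (𝒯 S) * weight S                                   ∎
      where
      c : Fin n → Subset n → Bool
      c x A = lookup (B⟨ S ⟩ ─ S) x ∧ (H⟨ S ⟩ ∋ᶠ x) A

  weight-bound : ∀ {S} → S ∈F 𝒯 → suc (m ∸ r) * weight S ≤ s * ((r ∸ t) * card H⟨ S ⟩)
  weight-bound {S} S∈𝒯 = begin
    suc (m ∸ r) * weight S                                       ≡⟨ *-distribˡ-∑χ* (suc (m ∸ r)) (allFin n) escaped h ⟩
    ∑[ x ∈ allFin n ] (χ (escaped x) * (suc (m ∸ r) * h x))       ≤⟨ ∑-mono-≤ (allFin n) (λ x → χ*-mono-≤ (escaped x) (shift x)) ⟩
    ∑[ x ∈ allFin n ] (χ (escaped x) * c)                        ≡⟨ ∑χ*-const (allFin n) escaped c ⟩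
    c * ∑[ x ∈ allFin n ] χ (escaped x)                          ≡⟨ cong (c *_) (∣p∣≡∑χ (B⟨ S ⟩ ─ S)) ⟨
    c * ∣ B⟨ S ⟩ ─ S ∣                                            ≤⟨ *-monoʳ-≤ c ∣B─S∣≤s ⟩
    c * s                                                        ≡⟨ *-comm c s ⟩
    s * c                                                        ∎
    where
    open ≤-Reasoning
    ∣S∣≡t : ∣ S ∣ ≡ t
    ∣S∣≡t = proj₂ (𝒯⁻ {S} S∈𝒯)
    c : ℕ
    c = (r ∸ t) * card H⟨ S ⟩
    escaped : Fin n → Bool
    escaped x = lookup (B⟨ S ⟩ ─ S) x
    h : Fin n → ℕ
    h x = card (H⟨ S ⟩ ∋ᶠ x)
    ∣B─S∣≤s : ∣ B⟨ S ⟩ ─ S ∣ ≤ s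
    ∣B─S∣≤s = ≤-trans (∣p─q∣≤∣p∣ B⟨ S ⟩ S) (≤-reflexive (ℬ-uniform B⟨ S ⟩ (proj₁ (escapes S ∣S∣≡t))))
    shift : ∀ x → T (escaped x) → suc (m ∸ r) * h x ≤ c
    shift x x∈B─S = subst (λ k → suc (m ∸ r) * h x ≤ (r ∸ k) * card H⟨ S ⟩) ∣S∣≡t (shift-bound {S} x∉S)
      where
      x∉S : x ∉ S
      x∉S = T-not⇒∉ (proj₂ (T-∧⁻ (lookup B⟨ S ⟩ x) (subst T (lookup-─ B⟨ S ⟩ S x) x∈B─S)))

  total-bound : 0 < card 𝒜 → card 𝒜 * (m ∸ r) < ∑[ S ∈ 𝒫 ] (χ (𝒯 S) * (s * ((r ∸ t) * card H⟨ S ⟩)))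
  total-bound 𝒜-nonempty = begin-strict
    card 𝒜 * (m ∸ r)                                      ≡⟨ *-comm (card 𝒜) (m ∸ r) ⟩
    (m ∸ r) * card 𝒜                                      <⟨ m<n+m ((m ∸ r) * card 𝒜) 𝒜-nonempty ⟩
    suc (m ∸ r) * card 𝒜                                  ≤⟨ *-monoʳ-≤ (suc (m ∸ r)) card≤∑weight ⟩
    suc (m ∸ r) * ∑[ S ∈ 𝒫 ] (χ (𝒯 S) * weight S)         ≡⟨ *-distribˡ-∑χ* (suc (m ∸ r)) 𝒫 𝒯 weight ⟩
    ∑[ S ∈ 𝒫 ] (χ (𝒯 S) * (suc (m ∸ r) * weight S))       ≤⟨ ∑-mono-≤ 𝒫 (λ S → χ*-mono-≤ (𝒯 S) weight-bound) ⟩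
    ∑[ S ∈ 𝒫 ] (χ (𝒯 S) * (s * ((r ∸ t) * card H⟨ S ⟩)))  ∎
    where open ≤-Reasoning

lemma3p4 : (n t r s m : ℕ) (H 𝒜 ℬ : Family n) →
    1 ≤ t → t ≤ r →
    Hereditary H → IsMu H m → (r + r) ∸ t ≤ m →
    NonemptyF 𝒜 → 𝒜 ⊆F H → Uniform r 𝒜 →
    NonemptyF ℬ → Uniform s ℬ → ¬ TrivialTIntersecting t ℬ →
    CrossIntersecting t 𝒜 ℬ →
    Σ (Subset n) λ T → ∣ T ∣ ≡ t
      × (Σ (Subset n) λ B → B ∈F ℬ × T ⊆ B)
      × (card 𝒜 * (m ∸ r) < s * (r ∸ t) * (s C t) * card (uniformContaining H r T))
lemma3p4 n t r s m H 𝒜 ℬ _ _ hereditary (_ , bases-large) _ (_ , A∈𝒜) 𝒜⊆H 𝒜-uniform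
         (B₀ , B₀∈ℬ) ℬ-uniform nontrivial cross =
  let (S , S∈𝒯 , bound) = ∃-above-average 𝒯 f (card 𝒜 * (m ∸ r)) (total-bound (card-pos {F = 𝒜} A∈𝒜))
      (S⊆B₀ , ∣S∣≡t)    = 𝒯⁻ S∈𝒯
  in S , ∣S∣≡t , (B₀ , B₀∈ℬ , S⊆B₀) , subst (card 𝒜 * (m ∸ r) <_) (rearrange S) bound
  where
  open Covering hereditary bases-large 𝒜⊆H 𝒜-uniform ℬ-uniform cross B₀∈ℬ (escapeFrom ℬ)
                (λ S ∣S∣≡t → escapeFrom-spec nontrivial (≤-reflexive (sym ∣S∣≡t)))
  open +-*-Solver
  h : Subset n → ℕ
  h S = card (uniformContaining H r S)
  f : Subset n → ℕ
  f S = s * ((r ∸ t) * h S)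
  card𝒯≡sCt : card 𝒯 ≡ s C t
  card𝒯≡sCt = trans (card-choose B₀ t) (cong (_C t) (ℬ-uniform B₀ B₀∈ℬ))
  rearrange : ∀ S → card 𝒯 * f S ≡ s * (r ∸ t) * (s C t) * h S
  rearrange S = begin
    card 𝒯 * f S                 ≡⟨ cong (_* f S) card𝒯≡sCt ⟩
    (s C t) * f S                ≡⟨ solve 4 (λ a b k c → k :* (a :* (b :* c)) := a :* b :* k :* c)
                                            refl s (r ∸ t) (s C t) (h S) ⟩
    s * (r ∸ t) * (s C t) * h S  ∎
    where open ≡-Reasoning
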